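{- For a trihex, the following are equivalent: (1) the trihex has mirror symmetry, i.e., it can be embedded on the sphere so that a reflection of the sphere induces a graph isomorphism (automorphism) of it; (2) for every signature $(s,b,f)$ of the trihex, the triple $(s,b,(s-b-f)\bmod (s+1))$ is equivalent to $(s,b,f)$; (3) for some signature $(s,b,f)$ of the trihex, the triple $(s,b,(s-b-f)\bmod(s+1))$ is equivalent to $(s,b,f)$; (4) in the hexagonal tiling of the plane covering the trihex, there is a reflection in a line that bisects spines which maps special hexagons to special hexagons; (5) in the hexagonal tiling of the plane covering the trihex, there is a reflection in some line which maps special hexagons to special hexagons.
   Context: A trihex is a 3-regular graph embedded in the plane (equivalently the sphere) whose faces all have 3 or 6 sides, considered up to orientation-preserving homeomorphism. Every trihex arises as the quotient of the regular hexagonal tiling of the plane, positioned so hexagons lie in vertical columns, by the group generated by the $180^\circ$ rotations about the centers of a set of "special" hexagons whose centers form the vertices of a parallelogram lattice (the covering hexagonal tiling). Columns containing special hexagons are spine columns, the others belt columns. The spine length $s\ge0$ is the number of hexagons strictly between two consecutive special hexagons in a spine column; $b\ge0$ is the number of belt columns between two adjacent spine columns; the offset $f\in[0,s]$ is defined by: translating a special hexagon $b+1$ columns in the SW-to-NE direction lands it $f$ hexagons below a special hexagon. $(s,b,f)$ is a signature. Repeating this with columns in the directions $60^\circ$ and $120^\circ$ clockwise from north gives two more signatures; together these are the three equivalent signatures of the trihex, and two triples $(s,b,f)$ (integers, $s,b\ge0$, $0\le f\le s$) are called equivalent if they are signatures of the same trihex. Every such triple is a signature of exactly one trihex. The mirror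 image of the trihex with signature $(s,b,f)$ has signature $(s,b,(s-b-f)\bmod(s+1))$ (residue in $[0,s]$). A line in the covering tiling bisects spines if it passes through the centers of the hexagons of a spine column in one of the three column directions (vertical, SW-to-NE, or NW-to-SE). -}

module Defs where

open import Data.Nat as ℕ using (ℕ; zero; suc; _≤_; s≤s)
open import Data.Integer as ℤ using (ℤ; +_; -_; _+_; _-_; _*_; _%ℕ_)
open import Data.Integer.DivMod using (n%ℕd<d)
open import Data.Fin using (Fin; zero; suc)
open import Data.Product using (Σ; ∃; ∃-syntax; _×_; _,_)
open import Data.Sum using (_⊎_)
open import Relation.Binary.PropositionalEquality using (_≡_)
open import Relation.Binary.Construct.Closure.Equivalence using (EqClosure)

record Triple : Set where
  constructor ⟨_,_,_⟩[_]
  field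
    s b f : ℕ
    f≤s : f ≤ s
open Triple public

mirrorTriple : Triple → Triple
mirrorTriple ⟨ s , b , f ⟩[ _ ] =
  ⟨ s , b , ((+ s - + b - + f) %ℕ suc s) ⟩[ lemma ]
  where
  lemma : ((+ s - + b - + f) %ℕ suc s) ≤ s
  lemma with n%ℕd<d (+ s - + b - + f) (suc s)
  ... | s≤s p = p

-- The regular hexagonal tiling of the plane, hexagons in vertical
-- columns.  A hexagon is named by axial coordinates (c , r) ∈ ℤ²:
-- its centre is c·u + r·v, where v is the unit step to the hexagon
-- directly north (same column) and u the unit step to the north-east
-- neighbour (next column to the east).  Column c = const are the
-- vertical columns; u-lines and (u - v)-lines are the SW-to-NE and
-- NW-to-SE columns.

ℤ² : Set
ℤ² = ℤ × ℤ

_⊕_ : ℤ² → ℤ² → ℤ²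
(a , b) ⊕ (c , d) = (a + c , b + d)

neg : ℤ² → ℤ²
neg (a , b) = (- a , - b)

-- Special hexagons of the covering tiling of the trihex with signature
-- (s , b , f): a special hexagon at the origin; the next special
-- hexagon up the spine column is s+1 steps north; translating a
-- special hexagon b+1 columns SW-to-NE lands it f hexagons below a
-- special hexagon.
Special : Triple → ℤ² → Set
Special x p = ∃[ i ] ∃[ j ] (p ≡ (j * + suc (b x) , i * + suc (s x) + j * + f x))

-- The tiling as an oriented map.  A dart (h , k) is side k of hexagon
-- h, traversed counterclockwise as seen from h.  Sides are numbered
-- counterclockwise: 0 N, 1 NW, 2 SW, 3 S, 4 SE, 5 NE.

Dart : Set
Dart = ℤ² × Fin 6

next6 : Fin 6 → Fin 6
next6 zero = suc zero
next6 (suc zero) = suc (suc zero)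
next6 (suc (suc zero)) = suc (suc (suc zero))
next6 (suc (suc (suc zero))) = suc (suc (suc (suc zero)))
next6 (suc (suc (suc (suc zero)))) = suc (suc (suc (suc (suc zero))))
next6 (suc (suc (suc (suc (suc zero))))) = zero

prev6 : Fin 6 → Fin 6
prev6 k = next6 (next6 (next6 (next6 (next6 k))))

opp6 : Fin 6 → Fin 6
opp6 k = next6 (next6 (next6 k))

nbr : Fin 6 → ℤ²
nbr zero = (+ 0 , + 1)
nbr (suc zero) = (- + 1 , + 1)
nbr (suc (suc zero)) = (- + 1 , + 0)
nbr (suc (suc (suc zero))) = (+ 0 , - + 1)
nbr (suc (suc (suc (suc zero)))) = (+ 1 , - + 1)
nbr (suc (suc (suc (suc (suc zero))))) = (+ 1 , + 0)

α : Dart → Dart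
α (h , k) = (h ⊕ nbr k , opp6 k)

φ : Dart → Dart
φ (h , k) = (h , next6 k)

φ⁻¹ : Dart → Dart
φ⁻¹ (h , k) = (h , prev6 k)

iter : {A : Set} → (A → A) → ℕ → A → A
iter g zero a = a
iter g (suc n) a = g (iter g n a)

rot : ℤ² → Dart → Dart
rot p (h , k) = ((p ⊕ p) ⊕ neg h , opp6 k)

RotStep : Triple → Dart → Dart → Set
RotStep x d e = ∃[ p ] (Special x p × e ≡ rot p d)

-- darts of the trihex: orbits of the group generated by those half-turns
_∼[_]_ : Dart → Triple → Dart → Set
d ∼[ x ] e = EqClosure (RotStep x) d e

-- The trihex T(x) with signature x is the quotient map (darts modulo
-- ∼[ x ], with induced α and φ).

record Iso (x y : Triple) : Set where
  field
    ψ    : Dart → Dart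
    ψ⁻   : Dart → Dart
    ψ-cong  : ∀ {d e} → d ∼[ x ] e → ψ d ∼[ y ] ψ e
    ψ⁻-cong : ∀ {d e} → d ∼[ y ] e → ψ⁻ d ∼[ x ] ψ⁻ e
    left    : ∀ d → ψ⁻ (ψ d) ∼[ x ] d
    right   : ∀ d → ψ (ψ⁻ d) ∼[ y ] d
    ψ-α     : ∀ d → ψ (α d) ∼[ y ] α (ψ d)
    ψ-φ     : ∀ d → ψ (φ d) ∼[ y ] φ (ψ d)

Equivalent : Triple → Triple → Set
Equivalent x y = Iso x y

SignatureOf : Triple → Triple → Set
SignatureOf x y = Iso y x

-- an automorphism of T(x) induced by a reflection of the sphere:
-- an orientation-reversing map automorphism (faces are traversed
-- backwards), which is an involution and fixes some cell (a vertex,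
-- an edge, or a face), i.e. the induced involution has a fixed point.
record ReflectionAut (x : Triple) : Set where
  field
    ψ      : Dart → Dart
    ψ-cong : ∀ {d e} → d ∼[ x ] e → ψ d ∼[ x ] ψ e
    invol  : ∀ d → ψ (ψ d) ∼[ x ] d
    ψ-α    : ∀ d → ψ (α d) ∼[ x ] α (ψ d)
    ψ-φ    : ∀ d → ψ (φ d) ∼[ x ] α (φ⁻¹ (α (ψ d)))
    fixedCell : ∃[ d ]
      ( (∃[ n ] (ψ d ∼[ x ] iter (λ e → α (φ e)) n d))   -- head vertex of d fixed
      ⊎ ((ψ d ∼[ x ] d) ⊎ (ψ d ∼[ x ] α d))              -- edge of d fixed
      ⊎ (∃[ n ] (α (ψ d) ∼[ x ] iter φ n d)) )           -- face left of d fixed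

MirrorSymmetric : Triple → Set
MirrorSymmetric x = ReflectionAut x

-- Reflections of the plane preserving the hexagonal tiling.
-- Column directions: V (vertical, vector v), U (SW-to-NE, vector u),
-- W (NW-to-SE, vector u - v).

data Dir : Set where
  V U W : Dir

-- linear reflection fixing the direction d (axis parallel to d)
reflPar : Dir → ℤ² → ℤ²
reflPar V (c , r) = (- c , c + r)
reflPar U (c , r) = (c + r , - r)
reflPar W (c , r) = (- r , - c)

-- the six linear reflections of the tiling: axis parallel to a column
-- direction, or perpendicular to one
data LinRefl : Set where
  par perp : Dir → LinRefl

linApply : LinRefl → ℤ² → ℤ²
linApply (par d) p = reflPar d p
linApply (perp d) p = neg (reflPar d p)

-- a reflection in a line: p ↦ M p + t with M a linear reflection and
-- M t = - t (so it squares to the identity: not a glide reflection)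
record Reflection : Set where
  field
    M : LinRefl
    t : ℤ²
    isRefl : linApply M t ⊕ t ≡ (+ 0 , + 0)
open Reflection public

apply : Reflection → ℤ² → ℤ²
apply ρ p = linApply (M ρ) p ⊕ t ρ

PreservesSpecial : Triple → Reflection → Set
PreservesSpecial x ρ = ∀ p → Special x p → Special x (apply ρ p)

-- the mirror line passes through the centres of the hexagons of a
-- spine column: it is parallel to a column direction and passes
-- through the centre of a special hexagon
BisectsSpines : Triple → Reflection → Set
BisectsSpines x ρ = (∃[ d ] (M ρ ≡ par d)) × (∃[ p ] (Special x p × apply ρ p ≡ p))

{-# OPTIONS --safe #-}

-- A reflection automorphism ψ of T(x) lifts to the covering tiling. By connectedness ψ
-- agrees with the affine reflection of the tiling that matches it on a single dart. The
-- half-turn about a special hexagon p identifies the opposite sides of p; since ψ respects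
-- the orbits of the half-turns, the reflection sends p to a point with the same property,
-- that is, to a special hexagon. As the special hexagons form a lattice Λ, the linear part
-- of the reflection preserves Λ as well. Conversely a linear reflection of the tiling that
-- preserves Λ descends to a reflection automorphism fixing the face of the hexagon at the
-- origin. So each condition amounts to Λ being invariant under one of the six linear
-- reflections of the tiling. This property passes along isomorphisms (conjugate, then lift
-- again), and for a signature (s , b , f) it is equivalent to T(s , b , f′) ≅ T(s , b , f),
-- f′ = (s − b − f) mod (s + 1): as f + f′ + b + 1 ≡ 0 mod (s + 1), the reflection in the
-- vertical axis carries each of the two lattices onto the other, and composing it with a
-- second reflection gives an orientation-preserving isomorphism. Finally, a reflection
-- perpendicular to a column direction is the parallel one followed by the half-turn about
-- the origin, which preserves Λ, so the mirror can be chosen to bisect spines.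

module Submission where

open import Defs
open import Data.Fin using (Fin; toℕ)
open import Data.Fin.Patterns using (0F; 1F; 2F; 3F; 4F; 5F)
open import Data.Integer as ℤ using (ℤ; +_; -_; _+_; _-_; _*_; -[1+_]; _%ℕ_; _/ℕ_)
open import Data.Integer.DivMod using (a≡a%ℕn+[a/ℕn]*n)
import Data.Integer.Properties as ℤ
open import Data.Integer.Tactic.RingSolver using (solve-∀)
open import Data.Nat using (zero; suc)
open import Data.Product using (_×_; ∃-syntax; _,_; proj₁; proj₂)
open import Data.Sum using (_⊎_; inj₁; inj₂)
open import Function.Base using (_∘_)
open import Function.Bundles using (_⇔_; mk⇔; Equivalence)
open import Function.Construct.Composition using (_⇔-∘_)
open import Level using (0ℓ)
open import Relation.Nullary using (¬_; contradiction)
open import Relation.Binary.Bundles using (Setoid)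
open import Relation.Binary.Structures using (IsEquivalence)
open import Relation.Binary.PropositionalEquality
import Relation.Binary.Construct.Closure.Equivalence as EqClosure
import Relation.Binary.Reasoning.Setoid as SetoidReasoning
open import Algebra.Properties.CommutativeSemigroup ℤ.+-commutativeSemigroup
  using (interchange; xy∙z≈xz∙y)

∀-Fin6 : {P : Fin 6 → Set} → P 0F → P 1F → P 2F → P 3F → P 4F → P 5F → ∀ k → P k
∀-Fin6 p₀ p₁ p₂ p₃ p₄ p₅ 0F = p₀
∀-Fin6 p₀ p₁ p₂ p₃ p₄ p₅ 1F = p₁
∀-Fin6 p₀ p₁ p₂ p₃ p₄ p₅ 2F = p₂
∀-Fin6 p₀ p₁ p₂ p₃ p₄ p₅ 3F = p₃
∀-Fin6 p₀ p₁ p₂ p₃ p₄ p₅ 4F = p₄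
∀-Fin6 p₀ p₁ p₂ p₃ p₄ p₅ 5F = p₅

next6-cycle : ∀ k → next6 (next6 (next6 (next6 (next6 (next6 k))))) ≡ k
next6-cycle = ∀-Fin6 refl refl refl refl refl refl

opp6-irreflexive : ∀ k → ¬ opp6 k ≡ k
opp6-irreflexive = ∀-Fin6 (λ ()) (λ ()) (λ ()) (λ ()) (λ ()) (λ ())

nbr-opp6 : ∀ k → nbr (opp6 k) ≡ neg (nbr k)
nbr-opp6 = ∀-Fin6 refl refl refl refl refl refl

origin : ℤ²
origin = (+ 0 , + 0)

d₀ : Dart
d₀ = (origin , 0F)

⊕-identityˡ : ∀ p → origin ⊕ p ≡ p
⊕-identityˡ (a , b) = cong₂ _,_ (ℤ.+-identityˡ a) (ℤ.+-identityˡ b)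

⊕-identityʳ : ∀ p → p ⊕ origin ≡ p
⊕-identityʳ (a , b) = cong₂ _,_ (ℤ.+-identityʳ a) (ℤ.+-identityʳ b)

⊕-cancelʳ : ∀ p q → (p ⊕ q) ⊕ neg q ≡ p
⊕-cancelʳ (a , b) (c , d) = cong₂ _,_ (L a c) (L b d)
  where L : ∀ a c → (a + c) + - c ≡ a
        L = solve-∀

⊕-swapʳ : ∀ p q t → (p ⊕ q) ⊕ t ≡ (p ⊕ t) ⊕ q
⊕-swapʳ (a , b) (c , d) (e , f) = cong₂ _,_ (xy∙z≈xz∙y a c e) (xy∙z≈xz∙y b d f)

⊖-⊖ : ∀ p q r → (p ⊕ neg q) ⊕ neg r ≡ p ⊕ neg (q ⊕ r)
⊖-⊖ (a , b) (c , d) (e , f) = cong₂ _,_ (L a c e) (L b d f)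
  where L : ∀ a c e → (a + - c) + - e ≡ a + - (c + e)
        L = solve-∀

neg-involutive : ∀ p → neg (neg p) ≡ p
neg-involutive (a , b) = cong₂ _,_ (ℤ.neg-involutive a) (ℤ.neg-involutive b)

neg-⊕ : ∀ p q → neg (p ⊕ q) ≡ neg p ⊕ neg q
neg-⊕ (a , b) (c , d) = cong₂ _,_ (ℤ.neg-distrib-+ a c) (ℤ.neg-distrib-+ b d)

module Lattice (x : Triple) where

  Special-origin : Special x origin
  Special-origin = + 0 , + 0 , refl

  Special-⊕ : ∀ {p q} → Special x p → Special x q → Special x (p ⊕ q)
  Special-⊕ (i , j , refl) (i′ , j′ , refl) =
    i + i′ , j + j′ , cong₂ _,_ (sym (ℤ.*-distribʳ-+ _ j j′)) (L i i′ j j′ _ _)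
    where
    L : ∀ i i′ j j′ S F → (i * S + j * F) + (i′ * S + j′ * F) ≡ (i + i′) * S + (j + j′) * F
    L = solve-∀

  Special-neg : ∀ {p} → Special x p → Special x (neg p)
  Special-neg (i , j , refl) = - i , - j , cong₂ _,_ (ℤ.neg-distribˡ-* j _) (L i j _ _)
    where
    L : ∀ i j S F → - (i * S + j * F) ≡ (- i) * S + (- j) * F
    L = solve-∀

  Special-⊖ : ∀ {p q} → Special x p → Special x q → Special x (p ⊕ neg q)
  Special-⊖ sp sq = Special-⊕ sp (Special-neg sq)

-- The half-turn group

translate : ℤ² → Dart → Dart
translate t (h , k) = (h ⊕ t , k)

translate-origin : ∀ d → translate (origin ⊕ origin) d ≡ d
translate-origin (h , k) = cong (_, k) (⊕-identityʳ h)

translate-inverse : ∀ l d → translate (neg l ⊕ neg l) (translate (l ⊕ l) d) ≡ d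
translate-inverse l (h , k) = cong (_, k) (begin
  (h ⊕ (l ⊕ l)) ⊕ (neg l ⊕ neg l)  ≡⟨ cong ((h ⊕ (l ⊕ l)) ⊕_) (sym (neg-⊕ l l)) ⟩
  (h ⊕ (l ⊕ l)) ⊕ neg (l ⊕ l)      ≡⟨ ⊕-cancelʳ h (l ⊕ l) ⟩
  h                                ∎)
  where open ≡-Reasoning

rot-involutive : ∀ l d → rot l (rot l d) ≡ d
rot-involutive (c , d) ((a , b) , k) = cong₂ _,_ (cong₂ _,_ (L c a) (L d b)) (next6-cycle k)
  where L : ∀ c a → (c + c) + - ((c + c) + - a) ≡ a
        L = solve-∀

translate-translate : ∀ l l′ d →
                      translate (l′ ⊕ l′) (translate (l ⊕ l) d) ≡ translate ((l ⊕ l′) ⊕ (l ⊕ l′)) d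
translate-translate (c , d) (e , f) ((a , b) , k) = cong (_, k) (cong₂ _,_ (L a c e) (L b d f))
  where L : ∀ a c e → (a + (c + c)) + (e + e) ≡ a + ((c + e) + (c + e))
        L = solve-∀

rot-translate : ∀ l l′ d → rot l′ (translate (l ⊕ l) d) ≡ rot (l′ ⊕ neg l) d
rot-translate (c , d) (e , f) ((a , b) , k) = cong (_, opp6 k) (cong₂ _,_ (L a c e) (L b d f))
  where L : ∀ a c e → (e + e) + - (a + (c + c)) ≡ ((e + - c) + (e + - c)) + - a
        L = solve-∀

translate-rot : ∀ l l′ d → translate (l′ ⊕ l′) (rot l d) ≡ rot (l ⊕ l′) d
translate-rot (c , d) (e , f) ((a , b) , k) = cong (_, opp6 k) (cong₂ _,_ (L a c e) (L b d f))
  where L : ∀ a c e → ((c + c) + - a) + (e + e) ≡ ((c + e) + (c + e)) + - a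
        L = solve-∀

rot-rot : ∀ l l′ d → rot l′ (rot l d) ≡ translate ((l′ ⊕ neg l) ⊕ (l′ ⊕ neg l)) d
rot-rot (c , d) (e , f) ((a , b) , k) = cong₂ _,_ (cong₂ _,_ (L a c e) (L b d f)) (next6-cycle k)
  where L : ∀ a c e → (e + e) + - ((c + c) + - a) ≡ a + ((e + - c) + (e + - c))
        L = solve-∀

rot-centre : ∀ p k → rot p (p , k) ≡ (p , opp6 k)
rot-centre (a , b) k = cong (_, opp6 k) (cong₂ _,_ (L a) (L b))
  where L : ∀ a → (a + a) + - a ≡ a
        L = solve-∀

rot-fixed⇒centre : ∀ {q l} → q ≡ (l ⊕ l) ⊕ neg q → q ≡ l
rot-fixed⇒centre {a , b} {c , d} eq = cong₂ _,_ (halve (cong proj₁ eq)) (halve (cong proj₂ eq))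
  where
  halve : ∀ {a c} → a ≡ (c + c) + - a → a ≡ c
  halve {a} {c} eq = ℤ.*-cancelˡ-≡ (+ 2) a c (begin
    + 2 * a              ≡⟨ L₁ a ⟩
    a + a                ≡⟨ cong (_+ a) eq ⟩
    ((c + c) + - a) + a  ≡⟨ L₂ a c ⟩
    + 2 * c              ∎)
    where
    open ≡-Reasoning
    L₁ : ∀ a → + 2 * a ≡ a + a
    L₁ = solve-∀
    L₂ : ∀ a c → ((c + c) + - a) + a ≡ + 2 * c
    L₂ = solve-∀

α-rot : ∀ p d → α (rot p d) ≡ rot p (α d)
α-rot p (h , k) = cong (_, opp6 (opp6 k)) (begin
  ((p ⊕ p) ⊕ neg h) ⊕ nbr (opp6 k)  ≡⟨ cong (((p ⊕ p) ⊕ neg h) ⊕_) (nbr-opp6 k) ⟩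
  ((p ⊕ p) ⊕ neg h) ⊕ neg (nbr k)   ≡⟨ ⊖-⊖ (p ⊕ p) h (nbr k) ⟩
  (p ⊕ p) ⊕ neg (h ⊕ nbr k)         ∎)
  where open ≡-Reasoning

α-involutive : ∀ d → α (α d) ≡ d
α-involutive (h , k) rewrite nbr-opp6 k = cong₂ _,_ (⊕-cancelʳ h (nbr k)) (next6-cycle k)

φ-φ⁻¹ : ∀ d → φ (φ⁻¹ d) ≡ d
φ-φ⁻¹ (h , k) = cong (h ,_) (next6-cycle k)

φ⁻¹-φ : ∀ d → φ⁻¹ (φ d) ≡ d
φ⁻¹-φ (h , k) = cong (h ,_) (next6-cycle k)

-- Darts run counterclockwise around their hexagon, so an orientation-reversing
-- map turns φ into φᴿ: a step back around the hexagon across the edge.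
φᴿ : Dart → Dart
φᴿ d = α (φ⁻¹ (α d))

φᴿ-inverse : ∀ d → α (φ (α (φᴿ d))) ≡ d
φᴿ-inverse d = begin
  α (φ (α (α (φ⁻¹ (α d)))))  ≡⟨ cong (α ∘ φ) (α-involutive (φ⁻¹ (α d))) ⟩
  α (φ (φ⁻¹ (α d)))          ≡⟨ cong α (φ-φ⁻¹ (α d)) ⟩
  α (α d)                    ≡⟨ α-involutive d ⟩
  d                          ∎
  where open ≡-Reasoning

equivariant⇒cong : ∀ x z (f : Dart → Dart) (g : ℤ² → ℤ²) →
                   (∀ p → Special x p → Special z (g p)) →
                   (∀ p d → f (rot p d) ≡ rot (g p) (f d)) →
                   ∀ {d e} → d ∼[ x ] e → f d ∼[ z ] f e
equivariant⇒cong x z f g gΛ f-rot =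
  EqClosure.gmap f (λ (p , sp , e≡) → g p , gΛ p sp , trans (cong f e≡) (f-rot p _))

-- The half-turns about Λ generate the translations by 2Λ and the half-turns
-- about points of Λ, and these already form a group.
Orbit : Triple → Dart → Dart → Set
Orbit x d e = ∃[ l ] (Special x l × (e ≡ translate (l ⊕ l) d ⊎ e ≡ rot l d))

module Trihex (x : Triple) where
  open Lattice x

  ∼-setoid : Setoid 0ℓ 0ℓ
  ∼-setoid = EqClosure.setoid (RotStep x)

  open Setoid ∼-setoid public using ()
    renaming (refl to ∼-refl; sym to ∼-sym; trans to ∼-trans; reflexive to ≡⇒∼)
  module ∼-Reasoning = SetoidReasoning ∼-setoid

  Orbit-isEquivalence : IsEquivalence (Orbit x)
  Orbit-isEquivalence = record { refl = orbit-refl ; sym = orbit-sym ; trans = orbit-trans }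
    where
    orbit-refl : ∀ {d} → Orbit x d d
    orbit-refl {d} = origin , Special-origin , inj₁ (sym (translate-origin d))

    orbit-sym : ∀ {d e} → Orbit x d e → Orbit x e d
    orbit-sym {d} (l , sl , inj₁ refl) = neg l , Special-neg sl , inj₁ (sym (translate-inverse l d))
    orbit-sym {d} (l , sl , inj₂ refl) = l , sl , inj₂ (sym (rot-involutive l d))

    orbit-trans : ∀ {d e g} → Orbit x d e → Orbit x e g → Orbit x d g
    orbit-trans {d} (l , sl , inj₁ refl) (l′ , sl′ , inj₁ refl) =
      l ⊕ l′ , Special-⊕ sl sl′ , inj₁ (translate-translate l l′ d)
    orbit-trans {d} (l , sl , inj₁ refl) (l′ , sl′ , inj₂ refl) =
      l′ ⊕ neg l , Special-⊖ sl′ sl , inj₂ (rot-translate l l′ d)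
    orbit-trans {d} (l , sl , inj₂ refl) (l′ , sl′ , inj₁ refl) =
      l ⊕ l′ , Special-⊕ sl sl′ , inj₂ (translate-rot l l′ d)
    orbit-trans {d} (l , sl , inj₂ refl) (l′ , sl′ , inj₂ refl) =
      l′ ⊕ neg l , Special-⊖ sl′ sl , inj₁ (rot-rot l l′ d)

  ∼⇒Orbit : ∀ {d e} → d ∼[ x ] e → Orbit x d e
  ∼⇒Orbit = EqClosure.fold Orbit-isEquivalence (λ (p , sp , e≡) → p , sp , inj₂ e≡)

  ∼-opp⇒Special : ∀ {q k} → (q , k) ∼[ x ] (q , opp6 k) → Special x q
  ∼-opp⇒Special {q} {k} r with ∼⇒Orbit r
  ... | l , sl , inj₁ eq = contradiction (cong proj₂ eq) (opp6-irreflexive k)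
  ... | l , sl , inj₂ eq = subst (Special x) (sym (rot-fixed⇒centre (cong proj₁ eq))) sl

  Special⇒∼-opp : ∀ {q} k → Special x q → (q , k) ∼[ x ] (q , opp6 k)
  Special⇒∼-opp {q} k sq = EqClosure.return (q , sq , sym (rot-centre q k))

  α-cong : ∀ {d e} → d ∼[ x ] e → α d ∼[ x ] α e
  α-cong = equivariant⇒cong x x α (λ p → p) (λ _ sp → sp) α-rot

  -- φ and φ⁻¹ commute with rot p definitionally, as opp6 is a power of next6.
  φ-cong : ∀ {d e} → d ∼[ x ] e → φ d ∼[ x ] φ e
  φ-cong = equivariant⇒cong x x φ (λ p → p) (λ _ sp → sp) (λ _ _ → refl)

  φ⁻¹-cong : ∀ {d e} → d ∼[ x ] e → φ⁻¹ d ∼[ x ] φ⁻¹ e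
  φ⁻¹-cong = equivariant⇒cong x x φ⁻¹ (λ p → p) (λ _ sp → sp) (λ _ _ → refl)

  φᴿ-cong : ∀ {d e} → d ∼[ x ] e → φᴿ d ∼[ x ] φᴿ e
  φᴿ-cong = α-cong ∘ φ⁻¹-cong ∘ α-cong

-- Morphisms of trihexes

record Hom (x y : Triple) (ψ : Dart → Dart) : Set where
  field
    ψ-cong : ∀ {d e} → d ∼[ x ] e → ψ d ∼[ y ] ψ e
    ψ-α    : ∀ d → ψ (α d) ∼[ y ] α (ψ d)
    ψ-φ    : ∀ d → ψ (φ d) ∼[ y ] φ (ψ d)

record AntiHom (x y : Triple) (ψ : Dart → Dart) : Set where
  field
    ψ-cong : ∀ {d e} → d ∼[ x ] e → ψ d ∼[ y ] ψ e
    ψ-α    : ∀ d → ψ (α d) ∼[ y ] α (ψ d)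
    ψ-φ    : ∀ d → ψ (φ d) ∼[ y ] φᴿ (ψ d)

module _ {x y : Triple} {ψ : Dart → Dart} where
  open Trihex y
  open ∼-Reasoning

  Hom-φ⁻¹ : Hom x y ψ → ∀ d → ψ (φ⁻¹ d) ∼[ y ] φ⁻¹ (ψ d)
  Hom-φ⁻¹ H d = begin
    ψ (φ⁻¹ d)               ≡⟨ φ⁻¹-φ (ψ (φ⁻¹ d)) ⟨
    φ⁻¹ (φ (ψ (φ⁻¹ d)))     ≈⟨ φ⁻¹-cong (Hom.ψ-φ H (φ⁻¹ d)) ⟨
    φ⁻¹ (ψ (φ (φ⁻¹ d)))     ≡⟨ cong (φ⁻¹ ∘ ψ) (φ-φ⁻¹ d) ⟩
    φ⁻¹ (ψ d)               ∎

  Hom-φᴿ : Hom x y ψ → ∀ d → ψ (φᴿ d) ∼[ y ] φᴿ (ψ d)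
  Hom-φᴿ H d = begin
    ψ (α (φ⁻¹ (α d)))       ≈⟨ Hom.ψ-α H (φ⁻¹ (α d)) ⟩
    α (ψ (φ⁻¹ (α d)))       ≈⟨ α-cong (Hom-φ⁻¹ H (α d)) ⟩
    α (φ⁻¹ (ψ (α d)))       ≈⟨ α-cong (φ⁻¹-cong (Hom.ψ-α H d)) ⟩
    α (φ⁻¹ (α (ψ d)))       ∎

  AntiHom-φᴿ : AntiHom x y ψ → ∀ d → ψ (φᴿ d) ∼[ y ] φ (ψ d)
  AntiHom-φᴿ A d = begin
    ψ (α u)                       ≈⟨ AntiHom.ψ-α A u ⟩
    α (ψ u)                       ≡⟨ cong α (φᴿ-inverse (ψ u)) ⟨
    α (α (φ (α (φᴿ (ψ u)))))      ≈⟨ α-cong (α-cong (φ-cong (α-cong φᴿψu∼αψd))) ⟩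
    α (α (φ (α (α (ψ d)))))       ≡⟨ α-involutive (φ (α (α (ψ d)))) ⟩
    φ (α (α (ψ d)))               ≡⟨ cong φ (α-involutive (ψ d)) ⟩
    φ (ψ d)                       ∎
    where
    u : Dart
    u = φ⁻¹ (α d)
    φᴿψu∼αψd : φᴿ (ψ u) ∼[ y ] α (ψ d)
    φᴿψu∼αψd = begin
      φᴿ (ψ u)          ≈⟨ AntiHom.ψ-φ A u ⟨
      ψ (φ u)           ≡⟨ cong ψ (φ-φ⁻¹ (α d)) ⟩
      ψ (α d)           ≈⟨ AntiHom.ψ-α A d ⟩
      α (ψ d)           ∎

module _ {x y z : Triple} {g f : Dart → Dart} where
  open Trihex z

  Hom-∘-AntiHom : Hom y z g → AntiHom x y f → AntiHom x z (g ∘ f)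
  Hom-∘-AntiHom G F = record
    { ψ-cong = Hom.ψ-cong G ∘ AntiHom.ψ-cong F
    ; ψ-α    = λ d → ∼-trans (Hom.ψ-cong G (AntiHom.ψ-α F d)) (Hom.ψ-α G (f d))
    ; ψ-φ    = λ d → ∼-trans (Hom.ψ-cong G (AntiHom.ψ-φ F d)) (Hom-φᴿ G (f d))
    }

  AntiHom-∘-Hom : AntiHom y z g → Hom x y f → AntiHom x z (g ∘ f)
  AntiHom-∘-Hom G F = record
    { ψ-cong = AntiHom.ψ-cong G ∘ Hom.ψ-cong F
    ; ψ-α    = λ d → ∼-trans (AntiHom.ψ-cong G (Hom.ψ-α F d)) (AntiHom.ψ-α G (f d))
    ; ψ-φ    = λ d → ∼-trans (AntiHom.ψ-cong G (Hom.ψ-φ F d)) (AntiHom.ψ-φ G (f d))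
    }

  AntiHom-∘-AntiHom : AntiHom y z g → AntiHom x y f → Hom x z (g ∘ f)
  AntiHom-∘-AntiHom G F = record
    { ψ-cong = AntiHom.ψ-cong G ∘ AntiHom.ψ-cong F
    ; ψ-α    = λ d → ∼-trans (AntiHom.ψ-cong G (AntiHom.ψ-α F d)) (AntiHom.ψ-α G (f d))
    ; ψ-φ    = λ d → ∼-trans (AntiHom.ψ-cong G (AntiHom.ψ-φ F d)) (AntiHom-φᴿ G (f d))
    }

module _ {x y : Triple} (I : Iso x y) where
  open Iso I
  open Trihex x
  open ∼-Reasoning

  Iso⇒Hom : Hom x y ψ
  Iso⇒Hom = record { ψ-cong = ψ-cong ; ψ-α = ψ-α ; ψ-φ = ψ-φ }

  Iso⇒Hom⁻¹ : Hom y x ψ⁻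
  Iso⇒Hom⁻¹ = record { ψ-cong = ψ⁻-cong ; ψ-α = ψ⁻-α ; ψ-φ = ψ⁻-φ }
    where
    ψ⁻-α : ∀ e → ψ⁻ (α e) ∼[ x ] α (ψ⁻ e)
    ψ⁻-α e = begin
      ψ⁻ (α e)               ≈⟨ ψ⁻-cong (Trihex.α-cong y (right e)) ⟨
      ψ⁻ (α (ψ (ψ⁻ e)))      ≈⟨ ψ⁻-cong (ψ-α (ψ⁻ e)) ⟨
      ψ⁻ (ψ (α (ψ⁻ e)))      ≈⟨ left (α (ψ⁻ e)) ⟩
      α (ψ⁻ e)               ∎
    ψ⁻-φ : ∀ e → ψ⁻ (φ e) ∼[ x ] φ (ψ⁻ e)
    ψ⁻-φ e = begin
      ψ⁻ (φ e)               ≈⟨ ψ⁻-cong (Trihex.φ-cong y (right e)) ⟨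
      ψ⁻ (φ (ψ (ψ⁻ e)))      ≈⟨ ψ⁻-cong (ψ-φ (ψ⁻ e)) ⟨
      ψ⁻ (ψ (φ (ψ⁻ e)))      ≈⟨ left (φ (ψ⁻ e)) ⟩
      φ (ψ⁻ e)               ∎

  Iso-sym : Iso y x
  Iso-sym = record
    { ψ = ψ⁻ ; ψ⁻ = ψ ; ψ-cong = ψ⁻-cong ; ψ⁻-cong = ψ-cong ; left = right ; right = left
    ; ψ-α = Hom.ψ-α Iso⇒Hom⁻¹ ; ψ-φ = Hom.ψ-φ Iso⇒Hom⁻¹ }

Iso-refl : ∀ x → Iso x x
Iso-refl x = record
  { ψ = λ d → d ; ψ⁻ = λ d → d ; ψ-cong = λ r → r ; ψ⁻-cong = λ r → r
  ; left = λ _ → ∼-refl ; right = λ _ → ∼-refl ; ψ-α = λ _ → ∼-refl ; ψ-φ = λ _ → ∼-refl }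
  where open Trihex x

-- Reflections of the tiling

northImage : LinRefl → Fin 6
northImage (par V)  = 0F
northImage (par U)  = 4F
northImage (par W)  = 2F
northImage (perp V) = 3F
northImage (perp U) = 1F
northImage (perp W) = 5F

reflectionSendingNorthTo : Fin 6 → LinRefl
reflectionSendingNorthTo 0F = par V
reflectionSendingNorthTo 1F = perp U
reflectionSendingNorthTo 2F = par W
reflectionSendingNorthTo 3F = perp V
reflectionSendingNorthTo 4F = par U
reflectionSendingNorthTo 5F = perp W

northImage-reflectionSendingNorthTo : ∀ j → northImage (reflectionSendingNorthTo j) ≡ j
northImage-reflectionSendingNorthTo = ∀-Fin6 refl refl refl refl refl refl

reflectSide : LinRefl → Fin 6 → Fin 6
reflectSide m k = iter prev6 (toℕ k) (northImage m)

linApply-nbr : ∀ m k → linApply m (nbr k) ≡ nbr (reflectSide m k)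
linApply-nbr (par V)  = ∀-Fin6 refl refl refl refl refl refl
linApply-nbr (par U)  = ∀-Fin6 refl refl refl refl refl refl
linApply-nbr (par W)  = ∀-Fin6 refl refl refl refl refl refl
linApply-nbr (perp V) = ∀-Fin6 refl refl refl refl refl refl
linApply-nbr (perp U) = ∀-Fin6 refl refl refl refl refl refl
linApply-nbr (perp W) = ∀-Fin6 refl refl refl refl refl refl

reflectSide-next6 : ∀ m k → reflectSide m (next6 k) ≡ prev6 (reflectSide m k)
reflectSide-next6 (par V)  = ∀-Fin6 refl refl refl refl refl refl
reflectSide-next6 (par U)  = ∀-Fin6 refl refl refl refl refl refl
reflectSide-next6 (par W)  = ∀-Fin6 refl refl refl refl refl refl
reflectSide-next6 (perp V) = ∀-Fin6 refl refl refl refl refl refl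
reflectSide-next6 (perp U) = ∀-Fin6 refl refl refl refl refl refl
reflectSide-next6 (perp W) = ∀-Fin6 refl refl refl refl refl refl

reflectSide-opp6 : ∀ m k → reflectSide m (opp6 k) ≡ opp6 (reflectSide m k)
reflectSide-opp6 (par V)  = ∀-Fin6 refl refl refl refl refl refl
reflectSide-opp6 (par U)  = ∀-Fin6 refl refl refl refl refl refl
reflectSide-opp6 (par W)  = ∀-Fin6 refl refl refl refl refl refl
reflectSide-opp6 (perp V) = ∀-Fin6 refl refl refl refl refl refl
reflectSide-opp6 (perp U) = ∀-Fin6 refl refl refl refl refl refl
reflectSide-opp6 (perp W) = ∀-Fin6 refl refl refl refl refl refl

reflectSide-involutive : ∀ m k → reflectSide m (reflectSide m k) ≡ k
reflectSide-involutive (par V)  = ∀-Fin6 refl refl refl refl refl refl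
reflectSide-involutive (par U)  = ∀-Fin6 refl refl refl refl refl refl
reflectSide-involutive (par W)  = ∀-Fin6 refl refl refl refl refl refl
reflectSide-involutive (perp V) = ∀-Fin6 refl refl refl refl refl refl
reflectSide-involutive (perp U) = ∀-Fin6 refl refl refl refl refl refl
reflectSide-involutive (perp W) = ∀-Fin6 refl refl refl refl refl refl

reflPar-⊕ : ∀ d p q → reflPar d (p ⊕ q) ≡ reflPar d p ⊕ reflPar d q
reflPar-⊕ V (a , b) (c , d) = cong₂ _,_ (ℤ.neg-distrib-+ a c) (interchange a c b d)
reflPar-⊕ U (a , b) (c , d) = cong₂ _,_ (interchange a c b d) (ℤ.neg-distrib-+ b d)
reflPar-⊕ W (a , b) (c , d) = cong₂ _,_ (ℤ.neg-distrib-+ b d) (ℤ.neg-distrib-+ a c)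

reflPar-neg : ∀ d p → reflPar d (neg p) ≡ neg (reflPar d p)
reflPar-neg V (a , b) = cong (- - a ,_) (sym (ℤ.neg-distrib-+ a b))
reflPar-neg U (a , b) = cong (_, - - b) (sym (ℤ.neg-distrib-+ a b))
reflPar-neg W (a , b) = refl

reflPar-involutive : ∀ d p → reflPar d (reflPar d p) ≡ p
reflPar-involutive V (a , b) = cong₂ _,_ (ℤ.neg-involutive a) (L a b)
  where L : ∀ a b → - a + (a + b) ≡ b
        L = solve-∀
reflPar-involutive U (a , b) = cong₂ _,_ (L a b) (ℤ.neg-involutive b)
  where L : ∀ a b → (a + b) + - b ≡ a
        L = solve-∀
reflPar-involutive W (a , b) = cong₂ _,_ (ℤ.neg-involutive a) (ℤ.neg-involutive b)

linApply-⊕ : ∀ m p q → linApply m (p ⊕ q) ≡ linApply m p ⊕ linApply m q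
linApply-⊕ (par d)  p q = reflPar-⊕ d p q
linApply-⊕ (perp d) p q = trans (cong neg (reflPar-⊕ d p q)) (neg-⊕ (reflPar d p) (reflPar d q))

linApply-neg : ∀ m p → linApply m (neg p) ≡ neg (linApply m p)
linApply-neg (par d)  p = reflPar-neg d p
linApply-neg (perp d) p = cong neg (reflPar-neg d p)

linApply-involutive : ∀ m p → linApply m (linApply m p) ≡ p
linApply-involutive (par d)  p = reflPar-involutive d p
linApply-involutive (perp d) p = begin
  neg (reflPar d (neg (reflPar d p)))  ≡⟨ cong neg (reflPar-neg d (reflPar d p)) ⟩
  neg (neg (reflPar d (reflPar d p)))  ≡⟨ neg-involutive _ ⟩
  reflPar d (reflPar d p)              ≡⟨ reflPar-involutive d p ⟩
  p                                    ∎
  where open ≡-Reasoning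

linApply-origin : ∀ m → linApply m origin ≡ origin
linApply-origin (par V)  = refl
linApply-origin (par U)  = refl
linApply-origin (par W)  = refl
linApply-origin (perp V) = refl
linApply-origin (perp U) = refl
linApply-origin (perp W) = refl

linApply-origin-⊕ : ∀ m t → linApply m origin ⊕ t ≡ t
linApply-origin-⊕ m t = trans (cong (_⊕ t) (linApply-origin m)) (⊕-identityˡ t)

reflectDart : LinRefl → ℤ² → Dart → Dart
reflectDart m t (h , k) = (linApply m h ⊕ t , reflectSide m k)

reflectDart-α : ∀ m t d → reflectDart m t (α d) ≡ α (reflectDart m t d)
reflectDart-α m t (h , k) = cong₂ _,_ centre (reflectSide-opp6 m k)
  where
  open ≡-Reasoning
  centre : linApply m (h ⊕ nbr k) ⊕ t ≡ (linApply m h ⊕ t) ⊕ nbr (reflectSide m k)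
  centre = begin
    linApply m (h ⊕ nbr k) ⊕ t               ≡⟨ cong (_⊕ t) (linApply-⊕ m h (nbr k)) ⟩
    (linApply m h ⊕ linApply m (nbr k)) ⊕ t   ≡⟨ ⊕-swapʳ (linApply m h) _ t ⟩
    (linApply m h ⊕ t) ⊕ linApply m (nbr k)   ≡⟨ cong ((linApply m h ⊕ t) ⊕_) (linApply-nbr m k) ⟩
    (linApply m h ⊕ t) ⊕ nbr (reflectSide m k) ∎

reflectDart-φ : ∀ m t d → reflectDart m t (φ d) ≡ φ⁻¹ (reflectDart m t d)
reflectDart-φ m t (h , k) = cong (linApply m h ⊕ t ,_) (reflectSide-next6 m k)

reflectDart-rot : ∀ m t p d → reflectDart m t (rot p d) ≡ rot (linApply m p ⊕ t) (reflectDart m t d)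
reflectDart-rot m t p (h , k) = cong₂ _,_ centre (reflectSide-opp6 m k)
  where
  open ≡-Reasoning
  mp mh : ℤ²
  mp = linApply m p
  mh = linApply m h
  shift-centre : ∀ a b t → ((a ⊕ a) ⊕ neg b) ⊕ t ≡ ((a ⊕ t) ⊕ (a ⊕ t)) ⊕ neg (b ⊕ t)
  shift-centre (a , b) (c , d) (e , f) = cong₂ _,_ (L a c e) (L b d f)
    where L : ∀ a c e → ((a + a) + - c) + e ≡ ((a + e) + (a + e)) + - (c + e)
          L = solve-∀
  centre : linApply m ((p ⊕ p) ⊕ neg h) ⊕ t ≡ ((mp ⊕ t) ⊕ (mp ⊕ t)) ⊕ neg (mh ⊕ t)
  centre = begin
    linApply m ((p ⊕ p) ⊕ neg h) ⊕ t               ≡⟨ cong (_⊕ t) (linApply-⊕ m (p ⊕ p) (neg h)) ⟩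
    (linApply m (p ⊕ p) ⊕ linApply m (neg h)) ⊕ t
      ≡⟨ cong₂ (λ u v → (u ⊕ v) ⊕ t) (linApply-⊕ m p p) (linApply-neg m h) ⟩
    ((mp ⊕ mp) ⊕ neg mh) ⊕ t                        ≡⟨ shift-centre mp mh t ⟩
    ((mp ⊕ t) ⊕ (mp ⊕ t)) ⊕ neg (mh ⊕ t)            ∎

reflectDart-involutive : ∀ m d → reflectDart m origin (reflectDart m origin d) ≡ d
reflectDart-involutive m (h , k) = cong₂ _,_ centre (reflectSide-involutive m k)
  where
  open ≡-Reasoning
  centre : linApply m (linApply m h ⊕ origin) ⊕ origin ≡ h
  centre = begin
    linApply m (linApply m h ⊕ origin) ⊕ origin  ≡⟨ ⊕-identityʳ _ ⟩
    linApply m (linApply m h ⊕ origin)           ≡⟨ cong (linApply m) (⊕-identityʳ _) ⟩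
    linApply m (linApply m h)                    ≡⟨ linApply-involutive m h ⟩
    h                                            ∎

-- A reflection reverses the direction in which a side is traversed, so the
-- image of a dart is the opposite of the dart given by reflectDart.
reflection : LinRefl → ℤ² → Dart → Dart
reflection m t = α ∘ reflectDart m t

reflection-α : ∀ m t d → reflection m t (α d) ≡ α (reflection m t d)
reflection-α m t d = cong α (reflectDart-α m t d)

reflection-φ : ∀ m t d → reflection m t (φ d) ≡ φᴿ (reflection m t d)
reflection-φ m t d =
  trans (cong α (reflectDart-φ m t d)) (cong (α ∘ φ⁻¹) (sym (α-involutive (reflectDart m t d))))

reflection-rot : ∀ m t p d → reflection m t (rot p d) ≡ rot (linApply m p ⊕ t) (reflection m t d)
reflection-rot m t p d =
  trans (cong α (reflectDart-rot m t p d)) (α-rot (linApply m p ⊕ t) (reflectDart m t d))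

reflection-involutive : ∀ m d → reflection m origin (reflection m origin d) ≡ d
reflection-involutive m d = begin
  α (reflectDart m origin (α (reflectDart m origin d)))
    ≡⟨ cong α (reflectDart-α m origin (reflectDart m origin d)) ⟩
  α (α (reflectDart m origin (reflectDart m origin d)))
    ≡⟨ α-involutive (reflectDart m origin (reflectDart m origin d)) ⟩
  reflectDart m origin (reflectDart m origin d)          ≡⟨ reflectDart-involutive m d ⟩
  d                                                      ∎
  where open ≡-Reasoning

MapsSpecial : LinRefl → Triple → Triple → Set
MapsSpecial m x z = ∀ p → Special x p → Special z (linApply m p)

reflection-AntiHom : ∀ {x z} m → MapsSpecial m x z → AntiHom x z (reflection m origin)
reflection-AntiHom {x} {z} m mΛ = record
  { ψ-cong = equivariant⇒cong x z (reflection m origin) (λ p → linApply m p ⊕ origin) affineΛ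
                               (reflection-rot m origin)
  ; ψ-α    = λ d → ≡⇒∼ (reflection-α m origin d)
  ; ψ-φ    = λ d → ≡⇒∼ (reflection-φ m origin d)
  }
  where
  open Trihex z
  affineΛ : ∀ p → Special x p → Special z (linApply m p ⊕ origin)
  affineΛ p sp = subst (Special z) (sym (⊕-identityʳ (linApply m p))) (mΛ p sp)

-- Lifting orientation-reversing automorphisms

ℤ-induction : (P : ℤ → Set) → P (+ 0) →
              (∀ z → P z → P (ℤ.suc z)) → (∀ z → P z → P (ℤ.pred z)) → ∀ z → P z
ℤ-induction P p₀ up down (+ zero)     = p₀
ℤ-induction P p₀ up down (+ suc n)    = up (+ n) (ℤ-induction P p₀ up down (+ n))
ℤ-induction P p₀ up down -[1+ zero ]  = down (+ 0) p₀
ℤ-induction P p₀ up down -[1+ suc n ] = down -[1+ n ] (ℤ-induction P p₀ up down -[1+ n ])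

module _ (P : Dart → Set) (P-α : ∀ {d} → P d → P (α d)) (P-φ : ∀ {d} → P d → P (φ d)) where
  private
    AllSides : ℤ² → Set
    AllSides h = ∀ k → P (h , k)

    P-φⁿ : ∀ n {d} → P d → P (iter φ n d)
    P-φⁿ zero    p = p
    P-φⁿ (suc n) p = P-φ (P-φⁿ n p)

    from-north : ∀ {h} → P (h , 0F) → AllSides h
    from-north p = ∀-Fin6 (P-φⁿ 0 p) (P-φⁿ 1 p) (P-φⁿ 2 p) (P-φⁿ 3 p) (P-φⁿ 4 p) (P-φⁿ 5 p)

    to-north : ∀ {h} k → P (h , k) → P (h , 0F)
    to-north = ∀-Fin6 (P-φⁿ 0) (P-φⁿ 5) (P-φⁿ 4) (P-φⁿ 3) (P-φⁿ 2) (P-φⁿ 1)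

    across : ∀ {h h′} j → h ⊕ nbr j ≡ h′ → AllSides h → AllSides h′
    across j refl all = from-north (to-north (opp6 j) (P-α (all j)))

  connected : P d₀ → ∀ d → P d
  connected p ((c , r) , k) = everywhere c r k
    where
    onAxis : ∀ c → AllSides (c , + 0)
    onAxis = ℤ-induction (λ c → AllSides (c , + 0)) (from-north p)
      (λ c → across 5F (cong (_, + 0) (ℤ.+-comm c (+ 1))))
      (λ c → across 2F (cong (_, + 0) (ℤ.+-comm c (- + 1))))
    everywhere : ∀ c r → AllSides (c , r)
    everywhere c = ℤ-induction (λ r → AllSides (c , r)) (onAxis c)
      (λ r → across 0F (cong₂ _,_ (ℤ.+-identityʳ c) (ℤ.+-comm r (+ 1))))
      (λ r → across 3F (cong₂ _,_ (ℤ.+-identityʳ c) (ℤ.+-comm r (- + 1))))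

AntiHom-determined : ∀ {x y ψ} (χ : Dart → Dart) → AntiHom x y ψ →
                     (∀ d → χ (α d) ≡ α (χ d)) → (∀ d → χ (φ d) ≡ φᴿ (χ d)) →
                     ψ d₀ ∼[ y ] χ d₀ → ∀ d → ψ d ∼[ y ] χ d
AntiHom-determined {x} {y} {ψ} χ A χ-α χ-φ = connected (λ d → ψ d ∼[ y ] χ d) α-step φ-step
  where
  open Trihex y
  open ∼-Reasoning
  α-step : ∀ {d} → ψ d ∼[ y ] χ d → ψ (α d) ∼[ y ] χ (α d)
  α-step {d} r = begin
    ψ (α d)   ≈⟨ AntiHom.ψ-α A d ⟩
    α (ψ d)   ≈⟨ α-cong r ⟩
    α (χ d)   ≡⟨ χ-α d ⟨
    χ (α d)   ∎
  φ-step : ∀ {d} → ψ d ∼[ y ] χ d → ψ (φ d) ∼[ y ] χ (φ d)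
  φ-step {d} r = begin
    ψ (φ d)   ≈⟨ AntiHom.ψ-φ A d ⟩
    φᴿ (ψ d)  ≈⟨ φᴿ-cong r ⟩
    φᴿ (χ d)  ≡⟨ χ-φ d ⟨
    χ (φ d)   ∎

SymmetricLattice : Triple → Set
SymmetricLattice x = ∃[ m ] MapsSpecial m x x

affine⇒linear : ∀ x z m t → (∀ p → Special x p → Special z (linApply m p ⊕ t)) → MapsSpecial m x z
affine⇒linear x z m t affineΛ p sp =
  subst (Special z) (⊕-cancelʳ (linApply m p) t) (Special-⊖ (affineΛ p sp) tΛ)
  where
  open Lattice z
  tΛ : Special z t
  tΛ = subst (Special z) (linApply-origin-⊕ m t) (affineΛ origin (Lattice.Special-origin x))

AntiHom⇒SymmetricLattice : ∀ {x ψ} → AntiHom x x ψ → SymmetricLattice x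
AntiHom⇒SymmetricLattice {x} {ψ} A = m , affine⇒linear x x m t₀ affineΛ
  where
  open Trihex x
  open ∼-Reasoning
  t₀ : ℤ²
  t₀ = proj₁ (α (ψ d₀))
  m : LinRefl
  m = reflectionSendingNorthTo (proj₂ (α (ψ d₀)))
  at-d₀ : ψ d₀ ∼[ x ] reflection m t₀ d₀
  at-d₀ = begin
    ψ d₀                                   ≡⟨ α-involutive (ψ d₀) ⟨
    α (α (ψ d₀))                           ≡⟨ cong α (cong₂ _,_ (linApply-origin-⊕ m t₀) north) ⟨
    α (linApply m origin ⊕ t₀ , northImage m) ∎
    where
    north : northImage m ≡ proj₂ (α (ψ d₀))
    north = northImage-reflectionSendingNorthTo (proj₂ (α (ψ d₀)))
  agree : ∀ d → ψ d ∼[ x ] reflection m t₀ d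
  agree = AntiHom-determined (reflection m t₀) A (reflection-α m t₀) (reflection-φ m t₀) at-d₀
  affineΛ : ∀ p → Special x p → Special x (linApply m p ⊕ t₀)
  affineΛ p sp = ∼-opp⇒Special (begin
    (linApply m p ⊕ t₀ , reflectSide m 0F)         ≡⟨ α-involutive (reflectDart m t₀ (p , 0F)) ⟨
    α (reflection m t₀ (p , 0F))                   ≈⟨ α-cong (agree (p , 0F)) ⟨
    α (ψ (p , 0F))                                 ≈⟨ α-cong (AntiHom.ψ-cong A (Special⇒∼-opp 0F sp)) ⟩
    α (ψ (p , 3F))                                 ≈⟨ α-cong (agree (p , 3F)) ⟩
    α (reflection m t₀ (p , 3F))                   ≡⟨ α-involutive (reflectDart m t₀ (p , 3F)) ⟩
    (linApply m p ⊕ t₀ , reflectSide m 3F)         ≡⟨ cong (linApply m p ⊕ t₀ ,_) (reflectSide-opp6 m 0F) ⟩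
    (linApply m p ⊕ t₀ , opp6 (reflectSide m 0F))  ∎)

face₀-fixed : ∀ m → α (reflection m origin d₀) ≡ iter φ (toℕ (northImage m)) d₀
face₀-fixed (par V)  = refl
face₀-fixed (par U)  = refl
face₀-fixed (par W)  = refl
face₀-fixed (perp V) = refl
face₀-fixed (perp U) = refl
face₀-fixed (perp W) = refl

ReflectionAut⇒AntiHom : ∀ {x} (A : ReflectionAut x) → AntiHom x x (ReflectionAut.ψ A)
ReflectionAut⇒AntiHom A = record
  { ψ-cong = ReflectionAut.ψ-cong A ; ψ-α = ReflectionAut.ψ-α A ; ψ-φ = ReflectionAut.ψ-φ A }

MirrorSymmetric⇔SymmetricLattice : ∀ x → MirrorSymmetric x ⇔ SymmetricLattice x
MirrorSymmetric⇔SymmetricLattice x = mk⇔ to from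
  where
  open Trihex x
  to : MirrorSymmetric x → SymmetricLattice x
  to A = AntiHom⇒SymmetricLattice (ReflectionAut⇒AntiHom A)
  from : SymmetricLattice x → MirrorSymmetric x
  from (m , mΛ) = record
    { ψ         = reflection m origin
    ; ψ-cong    = AntiHom.ψ-cong A
    ; invol     = λ d → ≡⇒∼ (reflection-involutive m d)
    ; ψ-α       = AntiHom.ψ-α A
    ; ψ-φ       = AntiHom.ψ-φ A
    ; fixedCell = d₀ , inj₂ (inj₂ (toℕ (northImage m) , ≡⇒∼ (face₀-fixed m)))
    }
    where
    A : AntiHom x x (reflection m origin)
    A = reflection-AntiHom m mΛ

-- Signatures and reflections of the plane

SymmetricLattice-transport : ∀ {x y} → Iso y x → SymmetricLattice x → SymmetricLattice y
SymmetricLattice-transport I (m , mΛ) = AntiHom⇒SymmetricLattice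
  (Hom-∘-AntiHom (Iso⇒Hom⁻¹ I) (AntiHom-∘-Hom (reflection-AntiHom m mΛ) (Iso⇒Hom I)))

-- The hypothesis is symmetric in f y and f z, so this gives both directions.
reflectV-MapsSpecial : ∀ y z k → s z ≡ s y → b z ≡ b y →
                       + f y + + f z + + suc (b y) ≡ k * + suc (s y) → MapsSpecial (par V) y z
reflectV-MapsSpecial ⟨ s , b , f ⟩[ _ ] ⟨ _ , _ , f′ ⟩[ _ ] k refl refl eq p (i , j , refl) =
  i + j * k , - j , cong₂ _,_ (ℤ.neg-distribˡ-* j _) second
  where
  open ≡-Reasoning
  S B F F′ : ℤ
  S = + suc s
  B = + suc b
  F = + f
  F′ = + f′
  L₁ : ∀ i j S B F F′ → j * B + (i * S + j * F) ≡ i * S + j * (F + F′ + B) + (- j) * F′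
  L₁ = solve-∀
  L₂ : ∀ i j k S F′ → i * S + j * (k * S) + (- j) * F′ ≡ (i + j * k) * S + (- j) * F′
  L₂ = solve-∀
  second : j * B + (i * S + j * F) ≡ (i + j * k) * S + (- j) * F′
  second = begin
    j * B + (i * S + j * F)                ≡⟨ L₁ i j S B F F′ ⟩
    i * S + j * (F + F′ + B) + (- j) * F′  ≡⟨ cong (λ X → i * S + j * X + (- j) * F′) eq ⟩
    i * S + j * (k * S) + (- j) * F′       ≡⟨ L₂ i j k S F′ ⟩
    (i + j * k) * S + (- j) * F′           ∎

-- + suc n is written + 1 + + n below so that the ring solver sees n.
mirror-offsets : ∀ y → ∃[ k ] (+ f y + + f (mirrorTriple y) + + suc (b y) ≡ k * + suc (s y))
mirror-offsets ⟨ s , b , f ⟩[ _ ] = + 1 - q , (begin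
    + f + F′ + (+ 1 + + b)                            ≡⟨ L₁ (+ f) F′ (+ b) q (+ 1 + + s) ⟩
    + f + (F′ + q * (+ 1 + + s)) + (+ 1 + + b) - q * (+ 1 + + s)
      ≡⟨ cong (λ X → + f + X + (+ 1 + + b) - q * (+ 1 + + s)) (sym division) ⟩
    + f + (+ s - + b - + f) + (+ 1 + + b) - q * (+ 1 + + s)
      ≡⟨ L₂ (+ f) (+ s) (+ b) q ⟩
    (+ 1 - q) * (+ 1 + + s)                           ∎)
  where
  open ≡-Reasoning
  z q F′ : ℤ
  z = + s - + b - + f
  q = z /ℕ suc s
  F′ = + (z %ℕ suc s)
  division : z ≡ F′ + q * + suc s
  division = a≡a%ℕn+[a/ℕn]*n z (suc s)
  L₁ : ∀ F F′ b q S → F + F′ + (+ 1 + b) ≡ F + (F′ + q * S) + (+ 1 + b) - q * S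
  L₁ = solve-∀
  L₂ : ∀ f s b q → f + (s - b - f) + (+ 1 + b) - q * (+ 1 + s) ≡ (+ 1 - q) * (+ 1 + s)
  L₂ = solve-∀

mirror-MapsSpecial : ∀ y → MapsSpecial (par V) y (mirrorTriple y)
mirror-MapsSpecial y with mirror-offsets y
... | k , eq = reflectV-MapsSpecial y (mirrorTriple y) k refl refl eq

mirror-MapsSpecial⁻¹ : ∀ y → MapsSpecial (par V) (mirrorTriple y) y
mirror-MapsSpecial⁻¹ y with mirror-offsets y
... | k , eq = reflectV-MapsSpecial (mirrorTriple y) y k refl refl
                 (trans (cong (_+ + suc (b y)) (ℤ.+-comm (+ f (mirrorTriple y)) (+ f y))) eq)

SymmetricLattice⇔mirror-Equivalent : ∀ y → SymmetricLattice y ⇔ Equivalent (mirrorTriple y) y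
SymmetricLattice⇔mirror-Equivalent y = mk⇔ to from
  where
  y′ : Triple
  y′ = mirrorTriple y
  from : Equivalent y′ y → SymmetricLattice y
  from J = AntiHom⇒SymmetricLattice
    (Hom-∘-AntiHom (Iso⇒Hom J) (reflection-AntiHom (par V) (mirror-MapsSpecial y)))
  cancel : ∀ m′ m d →
           reflection m′ origin (reflection m origin (reflection m origin (reflection m′ origin d))) ≡ d
  cancel m′ m d = trans (cong (reflection m′ origin) (reflection-involutive m (reflection m′ origin d)))
                        (reflection-involutive m′ d)
  to : SymmetricLattice y → Equivalent y′ y
  to (m , mΛ) = record
    { ψ       = reflection m origin ∘ reflection (par V) origin
    ; ψ⁻      = reflection (par V) origin ∘ reflection m origin
    ; ψ-cong  = Hom.ψ-cong H
    ; ψ⁻-cong = Hom.ψ-cong H⁻¹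
    ; left    = λ d → Trihex.≡⇒∼ y′ (cancel (par V) m d)
    ; right   = λ d → Trihex.≡⇒∼ y (cancel m (par V) d)
    ; ψ-α     = Hom.ψ-α H
    ; ψ-φ     = Hom.ψ-φ H
    }
    where
    H : Hom y′ y (reflection m origin ∘ reflection (par V) origin)
    H = AntiHom-∘-AntiHom {y = y} (reflection-AntiHom m mΛ)
                                  (reflection-AntiHom (par V) (mirror-MapsSpecial⁻¹ y))
    H⁻¹ : Hom y y′ (reflection (par V) origin ∘ reflection m origin)
    H⁻¹ = AntiHom-∘-AntiHom {y = y} (reflection-AntiHom (par V) (mirror-MapsSpecial y))
                                    (reflection-AntiHom m mΛ)

SymmetricLattice⇔all-signatures : ∀ x →
  SymmetricLattice x ⇔ (∀ y → SignatureOf x y → Equivalent (mirrorTriple y) y)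
SymmetricLattice⇔all-signatures x = mk⇔
  (λ Λx y I → Equivalence.to (SymmetricLattice⇔mirror-Equivalent y) (SymmetricLattice-transport I Λx))
  (λ all → Equivalence.from (SymmetricLattice⇔mirror-Equivalent x) (all x (Iso-refl x)))

SymmetricLattice⇔some-signature : ∀ x →
  SymmetricLattice x ⇔ (∃[ y ] (SignatureOf x y × Equivalent (mirrorTriple y) y))
SymmetricLattice⇔some-signature x = mk⇔
  (λ Λx → x , Iso-refl x , Equivalence.to (SymmetricLattice⇔mirror-Equivalent x) Λx)
  (λ (y , I , J) →
     SymmetricLattice-transport (Iso-sym I) (Equivalence.from (SymmetricLattice⇔mirror-Equivalent y) J))

linearReflection : LinRefl → Reflection
linearReflection m = record { M = m ; t = origin ; isRefl = trans (⊕-identityʳ _) (linApply-origin m) }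

linearReflection-PreservesSpecial : ∀ x m → MapsSpecial m x x → PreservesSpecial x (linearReflection m)
linearReflection-PreservesSpecial x m mΛ p sp = subst (Special x) (sym (⊕-identityʳ _)) (mΛ p sp)

SymmetricLattice⇔PreservesSpecial : ∀ x → SymmetricLattice x ⇔ (∃[ ρ ] PreservesSpecial x ρ)
SymmetricLattice⇔PreservesSpecial x = mk⇔
  (λ (m , mΛ) → linearReflection m , linearReflection-PreservesSpecial x m mΛ)
  (λ (ρ , ρΛ) → M ρ , affine⇒linear x x (M ρ) (t ρ) ρΛ)

parallel-MapsSpecial : ∀ x m → MapsSpecial m x x → ∃[ d ] MapsSpecial (par d) x x
parallel-MapsSpecial x (par d) mΛ = d , mΛ
parallel-MapsSpecial x (perp d) mΛ =
  d , λ p sp → subst (Special x) (neg-involutive (reflPar d p)) (Lattice.Special-neg x (mΛ p sp))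

SymmetricLattice⇔spine-reflection : ∀ x →
  SymmetricLattice x ⇔ (∃[ ρ ] (BisectsSpines x ρ × PreservesSpecial x ρ))
SymmetricLattice⇔spine-reflection x = mk⇔ to from
  where
  to : SymmetricLattice x → ∃[ ρ ] (BisectsSpines x ρ × PreservesSpecial x ρ)
  to (m , mΛ) with parallel-MapsSpecial x m mΛ
  ... | d , dΛ = ρ , ((d , refl) , origin , Lattice.Special-origin x , isRefl ρ)
                   , linearReflection-PreservesSpecial x (par d) dΛ
    where
    ρ : Reflection
    ρ = linearReflection (par d)
  from : ∃[ ρ ] (BisectsSpines x ρ × PreservesSpecial x ρ) → SymmetricLattice x
  from (ρ , _ , ρΛ) = Equivalence.from (SymmetricLattice⇔PreservesSpecial x) (ρ , ρΛ)

proposition13 : (x : Triple) →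
    (MirrorSymmetric x ⇔ (∀ y → SignatureOf x y → Equivalent (mirrorTriple y) y))
    × (MirrorSymmetric x ⇔ (∃[ y ] (SignatureOf x y × Equivalent (mirrorTriple y) y)))
    × (MirrorSymmetric x ⇔ (∃[ ρ ] (BisectsSpines x ρ × PreservesSpecial x ρ)))
    × (MirrorSymmetric x ⇔ (∃[ ρ ] PreservesSpecial x ρ))
proposition13 x =
    SymmetricLattice⇔all-signatures x ⇔-∘ mirror⇔lattice
  , SymmetricLattice⇔some-signature x ⇔-∘ mirror⇔lattice
  , SymmetricLattice⇔spine-reflection x ⇔-∘ mirror⇔lattice
  , SymmetricLattice⇔PreservesSpecial x ⇔-∘ mirror⇔lattice
  where
  mirror⇔lattice : MirrorSymmetric x ⇔ SymmetricLattice x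
  mirror⇔lattice = MirrorSymmetric⇔SymmetricLattice x
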